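{- There exist a positive integer $k$ and a finite structure $M$ such that every finite structure that is $k$-equivalent to $M$ is rigid, but not every finite structure that is $k$-equivalent to $M$ is isomorphic to $M$.
   Context: All structures are finite and of a finite vocabulary. A structure is rigid if its only automorphism is the identity. $L^k_{\infty,\omega}$ is the fragment of $L_{\infty,\omega}$ consisting of formulas using at most $k$ distinct variables, where $L_{\infty,\omega}$ is the logic built from atomic formulas by negation, existential and universal quantification, and conjunctions and disjunctions of arbitrary sets of formulas whose total number of variables is finite. Two structures of the same vocabulary are $k$-equivalent if no $L^k_{\infty,\omega}$ sentence is true in one and false in the other. -}

module Defs where

open import Data.Nat using (ℕ; suc; _<_)
open import Data.Fin using (Fin; zero; _≟_)
open import Data.Bool using (Bool; true; false)
open import Data.Product using (Σ; _×_; ∃)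
open import Relation.Nullary using (¬_; yes; no)
open import Relation.Binary.PropositionalEquality using (_≡_)
open import Function using (_∘_)
open import Function.Bundles using (_↔_; _⇔_; Inverse)

record Vocab : Set where
  field
    nsym  : ℕ
    arity : Fin nsym → ℕ
open Vocab public

-- Its universe is Fin (suc size)
-- (nonempty, as usual; every finite structure is isomorphic to one
-- of this form).
record Structure (σ : Vocab) : Set where
  field
    size : ℕ
    rel  : (R : Fin (nsym σ)) → (Fin (arity σ R) → Fin (suc size)) → Bool
open Structure public

Univ : {σ : Vocab} → Structure σ → Set
Univ M = Fin (suc (size M))

record Iso {σ : Vocab} (M N : Structure σ) : Set where
  field
    bij      : Univ M ↔ Univ N
    preserve : (R : Fin (nsym σ)) (t : Fin (arity σ R) → Univ M) →
               rel M R t ≡ rel N R (Inverse.to bij ∘ t)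

Rigid : {σ : Vocab} → Structure σ → Set
Rigid M = (f : Iso M M) → (x : Univ M) → Inverse.to (Iso.bij f) x ≡ x

VarSet : ℕ → Set
VarSet k = Fin k → Bool

_,+_ : {k : ℕ} → VarSet k → Fin k → VarSet k
(S ,+ x) y with y ≟ x
... | yes _ = true
... | no  _ = S y

-- Formula σ k S : formulas of L^k_{∞ω} whose free variables lie in S.
-- Conjunctions/disjunctions are over arbitrary index sets.
data Formula (σ : Vocab) (k : ℕ) (S : VarSet k) : Set₁ where
  atom : (R : Fin (nsym σ)) (v : Fin (arity σ R) → Fin k) →
         (∀ j → S (v j) ≡ true) → Formula σ k S
  eq   : (x y : Fin k) → S x ≡ true → S y ≡ true → Formula σ k S
  neg  : Formula σ k S → Formula σ k S
  ⋀    : (I : Set) → (I → Formula σ k S) → Formula σ k S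
  ⋁    : (I : Set) → (I → Formula σ k S) → Formula σ k S
  ex   : (x : Fin k) → Formula σ k (S ,+ x) → Formula σ k S
  all  : (x : Fin k) → Formula σ k (S ,+ x) → Formula σ k S

_[_↦_] : {k : ℕ} {A : Set} → (Fin k → A) → Fin k → A → (Fin k → A)
(a [ x ↦ d ]) y with y ≟ x
... | yes _ = d
... | no  _ = a y

Sat : {σ : Vocab} {k : ℕ} {S : VarSet k} (M : Structure σ) →
      (Fin k → Univ M) → Formula σ k S → Set
Sat M a (atom R v _) = rel M R (a ∘ v) ≡ true
Sat M a (eq x y _ _) = a x ≡ a y
Sat M a (neg φ)      = ¬ Sat M a φ
Sat M a (⋀ I φ)      = (i : I) → Sat M a (φ i)
Sat M a (⋁ I φ)      = Σ I λ i → Sat M a (φ i)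
Sat M a (ex x φ)     = Σ (Univ M) λ d → Sat M (a [ x ↦ d ]) φ
Sat M a (all x φ)    = (d : Univ M) → Sat M (a [ x ↦ d ]) φ

Sentence : Vocab → ℕ → Set₁
Sentence σ k = Formula σ k (λ _ → false)

-- Truth of a sentence (evaluated under an arbitrary fixed assignment;
-- the value does not depend on it since there are no free variables).
_⊨_ : {σ : Vocab} {k : ℕ} → Structure σ → Sentence σ k → Set
M ⊨ φ = Sat M (λ _ → zero) φ

_≡[_]_ : {σ : Vocab} → Structure σ → ℕ → Structure σ → Set₁
_≡[_]_ {σ} M k N = (φ : Sentence σ k) → (M ⊨ φ) ⇔ (N ⊨ φ)

-- Take three unary colours, each holding of exactly one point of a
-- three-element universe, and a ternary relation that holds only of the
-- tuple of the three distinct points.  Two variables can say "every point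
-- has a colour and each colour holds of at most one point", so every
-- 2-equivalent structure is rigid.  But with two variables every atom
-- for the ternary relation repeats a variable, so it cannot see that
-- relation at all: emptying it gives a 2-equivalent, non-isomorphic
-- structure.
module Submission where

open import Defs
open import Data.Nat using (ℕ; _+_; _<_; s≤s; z≤n)
open import Data.Fin using (Fin; zero; suc; _≟_)
open import Data.Fin.Properties using (all?; pigeonhole; <⇒≢)
open import Data.Bool using (Bool; true; false)
open import Data.Bool.Properties using (¬-not; T-≡)
open import Data.Product using (Σ; _×_; _,_)
open import Data.Empty using (⊥-elim)
open import Function using (_∘_; id)
open import Function.Bundles using (Equivalence; _⇔_; mk⇔)
open import Relation.Nullary using (¬_; Dec; yes; no)
open import Relation.Nullary.Decidable using (isYes; toWitness; fromWitness)
open import Relation.Binary.PropositionalEquality using (_≡_; refl; sym; trans; cong)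

module _ {σ : Vocab} {k n : ℕ}
         (relM relN : (R : Fin (nsym σ)) → (Fin (arity σ R) → Fin (1 + n)) → Bool)
         (agree : ∀ R (a : Fin k → Fin (1 + n)) (v : Fin (arity σ R) → Fin k) →
                  relM R (a ∘ v) ≡ relN R (a ∘ v))
         where

  private
    M N : Structure σ
    M = record { size = n ; rel = relM }
    N = record { size = n ; rel = relN }

  Sat-agree : ∀ {S} (a : Fin k → Fin (1 + n)) (φ : Formula σ k S) → Sat M a φ ⇔ Sat N a φ
  Sat-agree a (atom R v _) = mk⇔ (trans (sym (agree R a v))) (trans (agree R a v))
  Sat-agree a (eq x y _ _) = mk⇔ id id
  Sat-agree a (neg φ)      = mk⇔ (λ ¬φ → ¬φ ∘ from) (λ ¬φ → ¬φ ∘ to)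
    where open Equivalence (Sat-agree a φ)
  Sat-agree a (⋀ I φ)      = mk⇔ (λ h i → Equivalence.to (Sat-agree a (φ i)) (h i))
                                 (λ h i → Equivalence.from (Sat-agree a (φ i)) (h i))
  Sat-agree a (⋁ I φ)      = mk⇔ (λ { (i , h) → i , Equivalence.to (Sat-agree a (φ i)) h })
                                 (λ { (i , h) → i , Equivalence.from (Sat-agree a (φ i)) h })
  Sat-agree a (ex x φ)     = mk⇔ (λ { (d , h) → d , Equivalence.to (Sat-agree (a [ x ↦ d ]) φ) h })
                                 (λ { (d , h) → d , Equivalence.from (Sat-agree (a [ x ↦ d ]) φ) h })
  Sat-agree a (all x φ)    = mk⇔ (λ h d → Equivalence.to (Sat-agree (a [ x ↦ d ]) φ) (h d))
                                 (λ h d → Equivalence.from (Sat-agree (a [ x ↦ d ]) φ) (h d))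

  agree⇒≡[k] : M ≡[ k ] N
  agree⇒≡[k] = Sat-agree _

module _ {σ : Vocab} where

  -- R holds of the constant tuple (x, …, x); for a unary R this is R x.
  _∋_ : (N : Structure σ) → Fin (nsym σ) × Univ N → Set
  N ∋ (R , x) = rel N R (λ _ → x) ≡ true

  record Named {I : Set} (c : I → Fin (nsym σ)) (N : Structure σ) : Set where
    constructor named
    field
      name        : (x : Univ N) → Σ I λ i → N ∋ (c i , x)
      name-unique : ∀ i x y → N ∋ (c i , x) → N ∋ (c i , y) → x ≡ y

  Named⇒Rigid : ∀ {I} {c : I → Fin (nsym σ)} {N : Structure σ} → Named c N → Rigid N
  Named⇒Rigid {c = c} (named name name-unique) f x with name x
  ... | i , x∈cᵢ = name-unique i _ x (trans (sym (Iso.preserve f (c i) (λ _ → x))) x∈cᵢ) x∈cᵢ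

  private
    x₀ x₁ : Fin 2
    x₀ = zero
    x₁ = suc zero

  everyPointNamed : {I : Set} → (I → Fin (nsym σ)) → Sentence σ 2
  everyPointNamed {I} c = all x₀ (⋁ I λ i → atom (c i) (λ _ → x₀) (λ _ → refl))

  namesUnique : {I : Set} → (I → Fin (nsym σ)) → Sentence σ 2
  namesUnique {I} c = ⋀ I λ i → all x₀ (all x₁ (⋁ Bool (λ
    { true  → neg (⋀ Bool λ { true  → atom (c i) (λ _ → x₀) (λ _ → refl)
                            ; false → atom (c i) (λ _ → x₁) (λ _ → refl) })
    ; false → eq x₀ x₁ refl refl })))

  ⊨namesUnique⇔ : ∀ {I} (c : I → Fin (nsym σ)) (N : Structure σ) →
                  N ⊨ namesUnique c ⇔ (∀ i x y → N ∋ (c i , x) → N ∋ (c i , y) → x ≡ y)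
  ⊨namesUnique⇔ c N = mk⇔ sound complete
    where
    sound : N ⊨ namesUnique c → ∀ i x y → N ∋ (c i , x) → N ∋ (c i , y) → x ≡ y
    sound h i x y x∈cᵢ y∈cᵢ with h i x y
    ... | false , x≡y = x≡y
    ... | true  , ¬both = ⊥-elim (¬both λ { true → x∈cᵢ ; false → y∈cᵢ })

    complete : (∀ i x y → N ∋ (c i , x) → N ∋ (c i , y) → x ≡ y) → N ⊨ namesUnique c
    complete unique i x y with x ≟ y
    ... | yes x≡y = false , x≡y
    ... | no  x≢y = true , λ both → x≢y (unique i x y (both true) (both false))

  ≡[2]-preserves-Named : ∀ {I} {c : I → Fin (nsym σ)} {M N : Structure σ} →
                         M ≡[ 2 ] N → Named c M → Named c N
  ≡[2]-preserves-Named {c = c} {M} {N} M≡N (named name name-unique) = named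
      (Equivalence.to (M≡N (everyPointNamed c)) name)
      (Equivalence.to (⊨namesUnique⇔ c N)
        (Equivalence.to (M≡N (namesUnique c)) (Equivalence.from (⊨namesUnique⇔ c M) name-unique)))

σ : Vocab
σ = record { nsym = 4 ; arity = λ { zero → 3 ; (suc _) → 1 } }

colour : Fin 3 → Fin (nsym σ)
colour = suc

colouredTriangle : ((Fin 3 → Fin 3) → Bool) → Structure σ
colouredTriangle T = record { size = 2 ; rel = λ { zero t → T t ; (suc i) t → isYes (t zero ≟ i) } }

isYes⇒witness : ∀ {A : Set} {a? : Dec A} → isYes a? ≡ true → A
isYes⇒witness h = toWitness (Equivalence.from T-≡ h)

isIdentity : (Fin 3 → Fin 3) → Bool
isIdentity t = isYes (all? λ i → t i ≟ i)

M N : Structure σ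
M = colouredTriangle isIdentity
N = colouredTriangle λ _ → false

isIdentity-2-variables : (a : Fin 2 → Fin 3) (v : Fin 3 → Fin 2) → isIdentity (a ∘ v) ≡ false
isIdentity-2-variables a v with pigeonhole (s≤s (s≤s (s≤s z≤n))) v
... | i , j , i<j , vi≡vj = ¬-not λ isId →
  <⇒≢ i<j (trans (sym (isYes⇒witness isId i))
                 (trans (cong a vi≡vj) (isYes⇒witness isId j)))

M≡[2]N : M ≡[ 2 ] N
M≡[2]N = agree⇒≡[k] (rel M) (rel N) λ
  { zero    a v → isIdentity-2-variables a v
  ; (suc i) a v → refl }

M-named : Named colour M
M-named = named (λ x → x , Equivalence.to T-≡ (fromWitness refl))
                λ i x y x∈cᵢ y∈cᵢ → trans (isYes⇒witness x∈cᵢ) (sym (isYes⇒witness y∈cᵢ))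

M≇N : ¬ Iso M N
M≇N f with Iso.preserve f zero id
... | ()

theorem4p2 : Σ ℕ λ k → 0 < k × Σ Vocab λ σ → Σ (Structure σ) λ M →
    ((N : Structure σ) → M ≡[ k ] N → Rigid N) ×
    Σ (Structure σ) (λ N → M ≡[ k ] N × ¬ Iso M N)
theorem4p2 = 2 , s≤s z≤n , σ , M ,
  (λ L M≡L → Named⇒Rigid (≡[2]-preserves-Named M≡L M-named)) ,
  N , M≡[2]N , M≇N
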